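{- For all integers $1 \le p \le q$, $\mathsf{bc}(G_{p,q}) \le \lfloor pq/2 \rfloor$.
   Context: For integers $p,q\ge 1$, the grid graph $G_{p,q}$ has vertex set $[q]\times[p]$, where $(a,b)$ is adjacent to $(a',b')$ if and only if $|a-a'|+|b-b'|=1$. A biclique of a graph $G$ is a complete bipartite subgraph of $G$. The biclique covering number $\mathsf{bc}(G)$ is the minimum number of bicliques of $G$ whose union contains every edge of $G$. -}

module Defs where

open import Data.Nat using (ℕ; _+_; _≤_)
open import Data.Fin using (Fin; toℕ)
open import Data.Product using (_×_; _,_; Σ; ∃)
open import Data.Sum using (_⊎_)
open import Data.List using (List; length)
open import Data.List.Relation.Unary.Any using (Any)
open import Relation.Binary.PropositionalEquality using (_≡_)

record Graph : Set₁ where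
  field
    V   : Set
    Adj : V → V → Set

open Graph public

-- The grid graph G_{p,q}: vertex set [q] × [p] (here Fin q × Fin p, i.e.
-- coordinates shifted by one), with (a,b) ~ (a',b') iff |a-a'| + |b-b'| = 1.
-- Written out over ℕ: one coordinate equal, the other differing by exactly 1.
gridAdj : (p q : ℕ) → (Fin q × Fin p) → (Fin q × Fin p) → Set
gridAdj p q (a , b) (a' , b') =
  (toℕ a ≡ toℕ a' × (suc' (toℕ b) ≡ toℕ b' ⊎ suc' (toℕ b') ≡ toℕ b))
  ⊎ (toℕ b ≡ toℕ b' × (suc' (toℕ a) ≡ toℕ a' ⊎ suc' (toℕ a') ≡ toℕ a))
  where
  suc' : ℕ → ℕ
  suc' n = n + 1

Grid : (p q : ℕ) → Graph
Grid p q = record { V = Fin q × Fin p ; Adj = gridAdj p q }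

-- A biclique of G: two vertex sets X, Y (as predicates) such that every
-- x ∈ X is adjacent in G to every y ∈ Y (a complete bipartite subgraph of G
-- with parts X and Y; X ∩ Y = ∅ is automatic since G has no loops).
record Biclique (G : Graph) : Set₁ where
  field
    X Y      : V G → Set
    complete : ∀ u v → X u → Y v → Adj G u v

open Biclique public

Covers : {G : Graph} → Biclique G → V G → V G → Set
Covers B u v = (X B u × Y B v) ⊎ (X B v × Y B u)

IsBicliqueCover : (G : Graph) → List (Biclique G) → Set₁
IsBicliqueCover G Bs = ∀ u v → Adj G u v → Any (λ B → Covers B u v) Bs

bc≤ : Graph → ℕ → Set₁
bc≤ G k = Σ (List (Biclique G)) λ Bs → length Bs ≤ k × IsBicliqueCover G Bs

-- Every edge of the grid joins a cell with even coordinate sum to one with odd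
-- coordinate sum, so the odd cells form a vertex cover, and the stars centred
-- at the vertices of any vertex cover form a biclique cover. Row by fins, two
-- consecutive rows together contain exactly p odd cells, so there are at most
-- pq/2 of them.
module Submission where

open import Defs
open import Data.Nat using (ℕ; zero; suc; _+_; _*_; _/_; _≤_; z≤n; parity)
open import Data.Nat.Properties
open import Data.Nat.DivMod using (m*n/n≡m; /-monoˡ-≤)
open import Data.Nat.Solver using (module +-*-Solver)
open import Data.Parity.Base using (Parity; 0ℙ; 1ℙ; _⁻¹)
open import Data.Parity.Properties using (suc-homo-⁻¹; ⁻¹-selfInverse)
open import Data.Fin using (Fin; toℕ; zero; suc)
open import Data.Product using (_×_; _,_; map₁)
open import Data.Sum using (_⊎_; inj₁; inj₂)
open import Data.List using (List; []; _∷_; _++_; length; map)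
open import Data.List.Properties using (length-++; length-map)
open import Data.List.Membership.Propositional using (_∈_)
open import Data.List.Membership.Propositional.Properties using (∈-map⁺; ∈-++⁺ˡ; ∈-++⁺ʳ)
open import Data.List.Relation.Unary.Any as Any using (here; there)
open import Data.List.Relation.Unary.Any.Properties using (map⁺)
open import Relation.Binary.PropositionalEquality

SymmetricGraph : Graph → Set
SymmetricGraph G = ∀ {u v} → Adj G u v → Adj G v u

IsVertexCover : (G : Graph) → List (V G) → Set
IsVertexCover G S = ∀ u v → Adj G u v → u ∈ S ⊎ v ∈ S

star : (G : Graph) → V G → Biclique G
star G w = record
  { X        = λ u → u ≡ w
  ; Y        = Adj G w
  ; complete = λ { u v refl w~v → w~v }
  }

stars-isBicliqueCover : ∀ {G} S → SymmetricGraph G → IsVertexCover G S →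
                        IsBicliqueCover G (map (star G) S)
stars-isBicliqueCover S sym-G cover u v u~v with cover u v u~v
... | inj₁ u∈S = map⁺ (Any.map (λ { refl → inj₁ (refl , u~v) }) u∈S)
... | inj₂ v∈S = map⁺ (Any.map (λ { refl → inj₂ (refl , sym-G u~v) }) v∈S)

bc≤-vertexCover : ∀ {G} S → SymmetricGraph G → IsVertexCover G S →
                  bc≤ G (length S)
bc≤-vertexCover {G} S sym-G cover =
  map (star G) S , ≤-reflexive (length-map (star G) S) , stars-isBicliqueCover S sym-G cover

bc≤-mono : ∀ {G k l} → k ≤ l → bc≤ G k → bc≤ G l
bc≤-mono k≤l (Bs , |Bs|≤k , cover) = Bs , ≤-trans |Bs|≤k k≤l , cover

double≤-twoStep : (f : ℕ → ℕ) (k : ℕ) → f 0 ≡ 0 → f 1 * 2 ≤ k →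
                  (∀ n → f (suc (suc n)) ≡ k + f n) → ∀ n → f n * 2 ≤ n * k
double≤-twoStep f k f0 f1 step zero rewrite f0 = z≤n
double≤-twoStep f k f0 f1 step (suc zero) = ≤-trans f1 (≤-reflexive (sym (+-identityʳ k)))
double≤-twoStep f k f0 f1 step (suc (suc n)) = begin
  f (suc (suc n)) * 2  ≡⟨ cong (_* 2) (step n) ⟩
  (k + f n) * 2        ≡⟨ *-distribʳ-+ 2 k (f n) ⟩
  k * 2 + f n * 2      ≤⟨ +-monoʳ-≤ (k * 2) (double≤-twoStep f k f0 f1 step n) ⟩
  k * 2 + n * k        ≡⟨ solve 2 (λ k n → k :* con 2 :+ n :* k := (con 2 :+ n) :* k) refl k n ⟩
  suc (suc n) * k      ∎
  where
  open ≤-Reasoning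
  open +-*-Solver

parity-pred : ∀ n {c} → parity (suc n) ≡ c → parity n ≡ c ⁻¹
parity-pred n refl = sym (suc-homo-⁻¹ n)

parity-neighbour : ∀ {m n} → suc m ≡ n ⊎ suc n ≡ m → parity n ≡ parity m ⁻¹
parity-neighbour {m} (inj₁ refl) = sym (⁻¹-selfInverse (suc-homo-⁻¹ m))
parity-neighbour {n = n} (inj₂ refl) = sym (suc-homo-⁻¹ n)

fins : Parity → (p : ℕ) → List (Fin p)
fins c  zero    = []
fins 0ℙ (suc p) = zero ∷ map suc (fins 1ℙ p)
fins 1ℙ (suc p) = map suc (fins 0ℙ p)

∈-fins : ∀ {p} c (b : Fin p) → parity (toℕ b) ≡ c → b ∈ fins c p
∈-fins 0ℙ zero    refl = here refl
∈-fins 0ℙ (suc b) e    = there (∈-map⁺ suc (∈-fins 1ℙ b (parity-pred (toℕ b) e)))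
∈-fins 1ℙ (suc b) e    = ∈-map⁺ suc (∈-fins 0ℙ b (parity-pred (toℕ b) e))

length-fins-complement : ∀ c p → length (fins c p) + length (fins (c ⁻¹) p) ≡ p
length-fins-complement c  zero    = refl
length-fins-complement 0ℙ (suc p) =
  cong suc (trans (cong₂ _+_ (length-map suc (fins 1ℙ p)) (length-map suc (fins 0ℙ p)))
                  (length-fins-complement 1ℙ p))
length-fins-complement 1ℙ (suc p) =
  trans (+-suc (length (map suc (fins 0ℙ p))) _)
        (cong suc (trans (cong₂ _+_ (length-map suc (fins 0ℙ p)) (length-map suc (fins 1ℙ p)))
                         (length-fins-complement 0ℙ p)))

length-oddFins : ∀ p → length (fins 1ℙ p) * 2 ≤ p
length-oddFins p = ≤-trans (double≤-twoStep (λ n → length (fins 1ℙ n)) 1 refl z≤n step p)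
                          (≤-reflexive (*-identityʳ p))
  where
  step : ∀ n → length (fins 1ℙ (suc (suc n))) ≡ 1 + length (fins 1ℙ n)
  step n = trans (length-map suc (zero ∷ map suc (fins 1ℙ n)))
                 (cong suc (length-map suc (fins 1ℙ n)))

cellSum : ∀ {p q} → Fin q × Fin p → ℕ
cellSum (a , b) = toℕ a + toℕ b

cells : Parity → (q p : ℕ) → List (Fin q × Fin p)
cells c zero    p = []
cells c (suc q) p = map (zero ,_) (fins c p) ++ map (map₁ suc) (cells (c ⁻¹) q p)

∈-cells : ∀ {p q} c (u : Fin q × Fin p) → parity (cellSum u) ≡ c → u ∈ cells c q p
∈-cells c (zero  , b) e = ∈-++⁺ˡ (∈-map⁺ (zero ,_) (∈-fins c b e))
∈-cells c (suc a , b) e =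
  ∈-++⁺ʳ _ (∈-map⁺ (map₁ suc) (∈-cells (c ⁻¹) (a , b) (parity-pred (cellSum (a , b)) e)))

length-cells-suc : ∀ c q p → length (cells c (suc q) p) ≡
                           length (fins c p) + length (cells (c ⁻¹) q p)
length-cells-suc c q p = begin
  length (map (zero ,_) (fins c p) ++ map (map₁ suc) (cells (c ⁻¹) q p))
    ≡⟨ length-++ (map (zero ,_) (fins c p)) ⟩
  length (map (zero ,_) (fins c p)) + length (map (map₁ suc) (cells (c ⁻¹) q p))
    ≡⟨ cong₂ _+_ (length-map (zero ,_) (fins c p)) (length-map (map₁ suc) (cells (c ⁻¹) q p)) ⟩
  length (fins c p) + length (cells (c ⁻¹) q p) ∎
  where open ≡-Reasoning

length-oddCells : ∀ q p → length (cells 1ℙ q p) * 2 ≤ q * p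
length-oddCells q p = double≤-twoStep (λ n → length (cells 1ℙ n p)) p refl one-row two-rows q
  where
  one-row : length (cells 1ℙ 1 p) * 2 ≤ p
  one-row rewrite length-cells-suc 1ℙ 0 p | +-identityʳ (length (fins 1ℙ p)) = length-oddFins p

  two-rows : ∀ n → length (cells 1ℙ (suc (suc n)) p) ≡ p + length (cells 1ℙ n p)
  two-rows n = begin
    length (cells 1ℙ (suc (suc n)) p)
      ≡⟨ length-cells-suc 1ℙ (suc n) p ⟩
    length (fins 1ℙ p) + length (cells 0ℙ (suc n) p)
      ≡⟨ cong (length (fins 1ℙ p) +_) (length-cells-suc 0ℙ n p) ⟩
    length (fins 1ℙ p) + (length (fins 0ℙ p) + length (cells 1ℙ n p))
      ≡⟨ sym (+-assoc (length (fins 1ℙ p)) _ _) ⟩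
    length (fins 1ℙ p) + length (fins 0ℙ p) + length (cells 1ℙ n p)
      ≡⟨ cong (_+ length (cells 1ℙ n p)) (length-fins-complement 1ℙ p) ⟩
    p + length (cells 1ℙ n p) ∎
    where open ≡-Reasoning

gridAdj-sym : ∀ {p q} → SymmetricGraph (Grid p q)
gridAdj-sym (inj₁ (e , inj₁ f)) = inj₁ (sym e , inj₂ f)
gridAdj-sym (inj₁ (e , inj₂ f)) = inj₁ (sym e , inj₁ f)
gridAdj-sym (inj₂ (e , inj₁ f)) = inj₂ (sym e , inj₂ f)
gridAdj-sym (inj₂ (e , inj₂ f)) = inj₂ (sym e , inj₁ f)

sum-stepʳ : ∀ {x x' y y'} → x ≡ x' → y + 1 ≡ y' → suc (x + y) ≡ x' + y'
sum-stepʳ {x} {y = y} refl refl = sym (trans (cong (x +_) (+-comm y 1)) (+-suc x y))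

sum-stepˡ : ∀ {x x' y y'} → x + 1 ≡ x' → y ≡ y' → suc (x + y) ≡ x' + y'
sum-stepˡ {x} {y = y} refl refl = cong (_+ y) (+-comm 1 x)

gridAdj⇒cellSum-neighbour : ∀ {p q} {u v : Fin q × Fin p} → gridAdj p q u v →
                            suc (cellSum u) ≡ cellSum v ⊎ suc (cellSum v) ≡ cellSum u
gridAdj⇒cellSum-neighbour (inj₁ (e , inj₁ f)) = inj₁ (sum-stepʳ e f)
gridAdj⇒cellSum-neighbour (inj₁ (e , inj₂ f)) = inj₂ (sum-stepʳ (sym e) f)
gridAdj⇒cellSum-neighbour (inj₂ (e , inj₁ f)) = inj₁ (sum-stepˡ f e)
gridAdj⇒cellSum-neighbour (inj₂ (e , inj₂ f)) = inj₂ (sum-stepˡ f (sym e))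

oddCells-isVertexCover : ∀ p q → IsVertexCover (Grid p q) (cells 1ℙ q p)
oddCells-isVertexCover p q u v u~v with parity (cellSum u) in eq
... | 1ℙ = inj₁ (∈-cells 1ℙ u eq)
... | 0ℙ = inj₂ (∈-cells 1ℙ v
                 (trans (parity-neighbour (gridAdj⇒cellSum-neighbour u~v)) (cong _⁻¹ eq)))

m*2≤n⇒m≤n/2 : ∀ {m n} → m * 2 ≤ n → m ≤ n / 2
m*2≤n⇒m≤n/2 {m} {n} m*2≤n = ≤-trans (≤-reflexive (sym (m*n/n≡m m 2))) (/-monoˡ-≤ 2 m*2≤n)

lemma2p1 : (p q : ℕ) → 1 ≤ p → p ≤ q → bc≤ (Grid p q) ((p * q) / 2)
lemma2p1 p q _ _ =
  bc≤-mono (m*2≤n⇒m≤n/2 (≤-trans (length-oddCells q p) (≤-reflexive (*-comm q p))))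
           (bc≤-vertexCover (cells 1ℙ q p) gridAdj-sym (oddCells-isVertexCover p q))
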